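{- Let $f:\mathbb{Z}\to\mathbb{Z}$ be a function such that $f(x)=-f(-x)$ for all $x\in\mathbb{Z}$ and such that the set $\{f(a+b)-f(a)-f(b): a,b\in\mathbb{N}\}$ is finite. Then $f$ is a near-endomorphism.
   Context: A function $f:\mathbb{Z}\to\mathbb{Z}$ is a near-endomorphism if there exists a constant $C$ such that $|f(a+b)-f(a)-f(b)|<C$ for all $a,b\in\mathbb{Z}$. $\mathbb{N}$ denotes the natural numbers. -}

module Defs where

open import Data.Nat using (ℕ) renaming (_<_ to _<ℕ_)
open import Data.Integer using (ℤ; +_; -_; _+_; _-_; ∣_∣)
open import Data.List using (List)
open import Data.List.Membership.Propositional using (_∈_)
open import Data.Product using (∃-syntax; Σ)
open import Relation.Binary.PropositionalEquality using (_≡_)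

defect : (ℤ → ℤ) → ℤ → ℤ → ℤ
defect f a b = f (a + b) - f a - f b

IsOdd : (ℤ → ℤ) → Set
IsOdd f = ∀ x → f x ≡ - f (- x)

NatDefectFinite : (ℤ → ℤ) → Set
NatDefectFinite f = Σ (List ℤ) λ L → ∀ (a b : ℕ) → defect f (+ a) (+ b) ∈ L

IsNearEndomorphism : (ℤ → ℤ) → Set
IsNearEndomorphism f = Σ ℕ λ C → (∀ (a b : ℤ) → ∣ defect f a b ∣ <ℕ C)

{-# OPTIONS --safe #-}
module Submission where

-- For odd f, the symmetries (a , b) ↦ (b , a), (a , b) ↦ (- a , - b) and
-- (a , b) ↦ (a + b , - b) change the defect at most by a sign, and every pair
-- of integers is carried by them to a pair of naturals. So every |defect|
-- already occurs as the absolute value of a defect on ℕ, and those lie in a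
-- finite list.

open import Defs
open import Data.Nat as ℕ using (suc; s≤s)
import Data.Nat.Properties as ℕ
open import Data.Integer using (ℤ; +_; -_; -[1+_]; _+_; _-_; ∣_∣)
open import Data.Integer.Properties using (+-comm; neg-involutive; neg-distrib-+; ∣-i∣≡∣i∣)
open import Data.Integer.Tactic.RingSolver using (solve-∀)
open import Data.List using (List; map)
open import Data.List.Extrema.Nat using (max; xs≤max)
open import Data.List.Membership.Propositional using (_∈_)
open import Data.List.Membership.Propositional.Properties using (∈-map⁺)
open import Data.List.Relation.Unary.All as All using ()
open import Data.Product using (∃₂; _,_)
open import Data.Sum using (inj₁; inj₂)
open import Relation.Binary.PropositionalEquality
open ≡-Reasoning

∣x∣≤max : ∀ {x} {xs : List ℤ} → x ∈ xs → ∣ x ∣ ℕ.≤ max 0 (map ∣_∣ xs)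
∣x∣≤max {xs = xs} x∈xs = All.lookup (xs≤max 0 (map ∣_∣ xs)) (∈-map⁺ ∣_∣ x∈xs)

m+k≡n⇒-k+n≡m : ∀ {m k n} → m ℕ.+ k ≡ n → - + k + + n ≡ + m
m+k≡n⇒-k+n≡m {m} {k} refl = cancel (+ m) (+ k)
  where
  cancel : ∀ x y → - y + (x + y) ≡ x
  cancel = solve-∀

defect-comm : ∀ (f : ℤ → ℤ) a b → defect f a b ≡ defect f b a
defect-comm f a b = begin
  f (a + b) - f a - f b  ≡⟨ cong (λ x → x - f a - f b) (cong f (+-comm a b)) ⟩
  f (b + a) - f a - f b  ≡⟨ swap (f (b + a)) (f a) (f b) ⟩
  f (b + a) - f b - f a  ∎
  where
  swap : ∀ x y z → x - y - z ≡ x - z - y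
  swap = solve-∀

module _ {f : ℤ → ℤ} (odd : IsOdd f) where

  odd-neg : ∀ x → f (- x) ≡ - f x
  odd-neg x = trans (odd (- x)) (cong (λ y → - f y) (neg-involutive x))

  defect-neg : ∀ a b → defect f (- a) (- b) ≡ - defect f a b
  defect-neg a b = begin
    f (- a + - b) - f (- a) - f (- b)
      ≡⟨ cong (λ x → f x - f (- a) - f (- b)) (sym (neg-distrib-+ a b)) ⟩
    f (- (a + b)) - f (- a) - f (- b)
      ≡⟨ cong₂ _-_ (cong₂ _-_ (odd-neg (a + b)) (odd-neg a)) (odd-neg b) ⟩
    - f (a + b) - - f a - - f b
      ≡⟨ negate (f (a + b)) (f a) (f b) ⟩
    - defect f a b ∎
    where
    negate : ∀ x y z → - x - - y - - z ≡ - (x - y - z)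
    negate = solve-∀

  defect-shift : ∀ {a b c} → a + b ≡ c → defect f c (- b) ≡ - defect f a b
  defect-shift {a} {b} refl = begin
    f (a + b + - b) - f (a + b) - f (- b)
      ≡⟨ cong₂ (λ x y → f x - f (a + b) - y) (cancel a b) (odd-neg b) ⟩
    f a - f (a + b) - - f b
      ≡⟨ negate (f (a + b)) (f a) (f b) ⟩
    - defect f a b ∎
    where
    cancel : ∀ x y → x + y + - y ≡ x
    cancel = solve-∀
    negate : ∀ x y z → y - x - - z ≡ - (x - y - z)
    negate = solve-∀

  ∣defect-neg∣ : ∀ a b → ∣ defect f (- a) (- b) ∣ ≡ ∣ defect f a b ∣
  ∣defect-neg∣ a b = trans (cong ∣_∣ (defect-neg a b)) (∣-i∣≡∣i∣ (defect f a b))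

  ∣defect-shift∣ : ∀ {a b c} → a + b ≡ c → ∣ defect f c (- b) ∣ ≡ ∣ defect f a b ∣
  ∣defect-shift∣ {a} {b} eq = trans (cong ∣_∣ (defect-shift eq)) (∣-i∣≡∣i∣ (defect f a b))

  ∣defect∣-ℕ-ℕ⁻ : ∀ m n → ∃₂ λ p q → ∣ defect f (+ m) (- + n) ∣ ≡ ∣ defect f (+ p) (+ q) ∣
  ∣defect∣-ℕ-ℕ⁻ m n with ℕ.≤-total n m
  ... | inj₁ n≤m =
    let k , n+k≡m = ℕ.m≤n⇒∃[o]m+o≡n n≤m
    in k , n , ∣defect-shift∣ (cong +_ (trans (ℕ.+-comm k n) n+k≡m))
  ... | inj₂ m≤n =
    let k , m+k≡n = ℕ.m≤n⇒∃[o]m+o≡n m≤n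
    in m , k , (begin
      ∣ defect f (+ m) (- + n) ∣      ≡⟨ ∣defect-shift∣ (m+k≡n⇒-k+n≡m m+k≡n) ⟩
      ∣ defect f (- + k) (+ n) ∣      ≡⟨ cong ∣_∣ (defect-comm f (- + k) (+ n)) ⟩
      ∣ defect f (+ n) (- + k) ∣      ≡⟨ ∣defect-shift∣ (cong +_ m+k≡n) ⟩
      ∣ defect f (+ m) (+ k) ∣        ∎)

  ∣defect∣-via-ℕ : ∀ a b → ∃₂ λ p q → ∣ defect f a b ∣ ≡ ∣ defect f (+ p) (+ q) ∣
  ∣defect∣-via-ℕ (+ m)    (+ n)    = m , n , refl
  ∣defect∣-via-ℕ (+ m)    -[1+ n ] = ∣defect∣-ℕ-ℕ⁻ m (suc n)
  ∣defect∣-via-ℕ -[1+ m ] (+ n)    =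
    let p , q , eq = ∣defect∣-ℕ-ℕ⁻ n (suc m)
    in p , q , trans (cong ∣_∣ (defect-comm f -[1+ m ] (+ n))) eq
  ∣defect∣-via-ℕ -[1+ m ] -[1+ n ] = suc m , suc n , ∣defect-neg∣ (+ suc m) (+ suc n)

mainTheorem5 : (f : ℤ → ℤ) → IsOdd f → NatDefectFinite f → IsNearEndomorphism f
mainTheorem5 f odd (L , defect∈L) = suc (max 0 (map ∣_∣ L)) , bound
  where
  bound : ∀ a b → ∣ defect f a b ∣ ℕ.< suc (max 0 (map ∣_∣ L))
  bound a b =
    let p , q , eq = ∣defect∣-via-ℕ odd a b
    in s≤s (subst (ℕ._≤ max 0 (map ∣_∣ L)) (sym eq) (∣x∣≤max (defect∈L p q)))
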